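{- Let $\mathcal{B}$ be any infinite atomic Boolean algebra (i.e. infinite, and every nonzero element has an atom below it), regarded as a structure in the language $\{0,1,\cap,\cup,\neg\}\cup\{C_n:n\geq 1\}$, where $C_n(x)$ holds iff at least $n$ distinct atoms lie below $x$. Then there is no formula $\varphi(x)$ of this language whose interpretation in $\mathcal{B}$ is a set $Fin$ satisfying: $Fin$ is a proper ideal of $\mathcal{B}$; every $x$ with at most $n$ atoms below it lies in $Fin$ (for each $n<\omega$); and for every $x\notin Fin$ there is $y<x$ with $y\notin Fin$ and $x-y\notin Fin$.
   Context: $x<y$ means $x\leq y$ and $x\ne y$; $x-y=x\cap\neg y$. The formula $\varphi(x)$ has $x$ as its only free variable (no parameters). -}

module Defs where

open import Level using (Level; _⊔_)
open import Data.Nat using (ℕ; suc)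
open import Data.Fin using (Fin; zero; suc)
open import Data.Product using (Σ; ∃; _×_; _,_)
open import Data.Sum using (_⊎_)
open import Data.Unit.Polymorphic using (⊤)
open import Data.Empty.Polymorphic using (⊥)
open import Relation.Nullary using (¬_)
open import Relation.Binary.PropositionalEquality using (_≡_)
open import Algebra.Lattice.Bundles using (BooleanAlgebra)

data Term (n : ℕ) : Set where
  var  : Fin n → Term n
  𝟘 𝟙  : Term n
  _∩_  : Term n → Term n → Term n
  _∪_  : Term n → Term n → Term n
  ∁_   : Term n → Term n

data Formula (n : ℕ) : Set where
  _≐_    : Term n → Term n → Formula n
  -- Cₛ k t  is the atomic formula C_{k+1}(t)  (so C_n for n ≥ 1)
  Cₛ     : ℕ → Term n → Formula n
  tt ff  : Formula n
  _∧'_   : Formula n → Formula n → Formula n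
  _∨'_   : Formula n → Formula n → Formula n
  _⇒'_   : Formula n → Formula n → Formula n
  ¬'_    : Formula n → Formula n
  ∀'     : Formula (suc n) → Formula n
  ∃'     : Formula (suc n) → Formula n

module _ {c ℓ : Level} (B : BooleanAlgebra c ℓ) where
  open BooleanAlgebra B renaming (¬_ to ∼_; ⊤ to 1ᴮ; ⊥ to 0ᴮ)

  _≤ᴮ_ : Carrier → Carrier → Set ℓ
  x ≤ᴮ y = (x ∧ y) ≈ x

  _<ᴮ_ : Carrier → Carrier → Set ℓ
  x <ᴮ y = (x ≤ᴮ y) × ¬ (x ≈ y)

  _-ᴮ_ : Carrier → Carrier → Carrier
  x -ᴮ y = x ∧ (∼ y)

  Atom : Carrier → Set (c ⊔ ℓ)
  Atom a = ¬ (a ≈ 0ᴮ) × (∀ y → y ≤ᴮ a → (y ≈ 0ᴮ) ⊎ (y ≈ a))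

  AtLeastAtoms : ℕ → Carrier → Set (c ⊔ ℓ)
  AtLeastAtoms n x =
    Σ (Fin n → Carrier) λ f →
      (∀ i → Atom (f i) × f i ≤ᴮ x) × (∀ i j → f i ≈ f j → i ≡ j)

  Infinite : Set (c ⊔ ℓ)
  Infinite = ¬ (Σ ℕ λ n → Σ (Fin n → Carrier) λ f → ∀ x → ∃ λ i → f i ≈ x)

  Atomic : Set (c ⊔ ℓ)
  Atomic = ∀ x → ¬ (x ≈ 0ᴮ) → ∃ λ a → Atom a × a ≤ᴮ x

  -- Tarskian semantics (intended to be read classically, see theorem4)
  Env : ℕ → Set c
  Env n = Fin n → Carrier

  ⟦_⟧ₜ : ∀ {n} → Term n → Env n → Carrier
  ⟦ var i ⟧ₜ ρ = ρ i
  ⟦ 𝟘 ⟧ₜ ρ = 0ᴮ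
  ⟦ 𝟙 ⟧ₜ ρ = 1ᴮ
  ⟦ s ∩ t ⟧ₜ ρ = ⟦ s ⟧ₜ ρ ∧ ⟦ t ⟧ₜ ρ
  ⟦ s ∪ t ⟧ₜ ρ = ⟦ s ⟧ₜ ρ ∨ ⟦ t ⟧ₜ ρ
  ⟦ ∁ t ⟧ₜ ρ = ∼ (⟦ t ⟧ₜ ρ)

  extend : ∀ {n} → Carrier → Env n → Env (suc n)
  extend x ρ zero = x
  extend x ρ (suc i) = ρ i

  ⟦_⟧ : ∀ {n} → Formula n → Env n → Set (c ⊔ ℓ)
  ⟦ s ≐ t ⟧ ρ = Level.Lift c (⟦ s ⟧ₜ ρ ≈ ⟦ t ⟧ₜ ρ)
  ⟦ Cₛ k t ⟧ ρ = AtLeastAtoms (suc k) (⟦ t ⟧ₜ ρ)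
  ⟦ tt ⟧ ρ = ⊤
  ⟦ ff ⟧ ρ = ⊥
  ⟦ φ ∧' ψ ⟧ ρ = ⟦ φ ⟧ ρ × ⟦ ψ ⟧ ρ
  ⟦ φ ∨' ψ ⟧ ρ = ⟦ φ ⟧ ρ ⊎ ⟦ ψ ⟧ ρ
  ⟦ φ ⇒' ψ ⟧ ρ = ⟦ φ ⟧ ρ → ⟦ ψ ⟧ ρ
  ⟦ ¬' φ ⟧ ρ = ¬ ⟦ φ ⟧ ρ
  ⟦ ∀' φ ⟧ ρ = ∀ x → ⟦ φ ⟧ (extend x ρ)
  ⟦ ∃' φ ⟧ ρ = Σ Carrier λ x → ⟦ φ ⟧ (extend x ρ)

  Def : Formula 1 → Carrier → Set (c ⊔ ℓ)
  Def φ x = ⟦ φ ⟧ (extend x (λ ()))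

  ProperIdeal : (Carrier → Set (c ⊔ ℓ)) → Set (c ⊔ ℓ)
  ProperIdeal I =
    I 0ᴮ ×
    (∀ x y → y ≤ᴮ x → I x → I y) ×
    (∀ x y → I x → I y → I (x ∨ y)) ×
    ¬ I 1ᴮ

  IsFinIdeal : (Carrier → Set (c ⊔ ℓ)) → Set (c ⊔ ℓ)
  IsFinIdeal I =
    ProperIdeal I ×
    (∀ (n : ℕ) x → ¬ AtLeastAtoms (suc n) x → I x) ×
    (∀ x → ¬ I x → ∃ λ y → (y <ᴮ x) × ¬ I y × ¬ I (x -ᴮ y))

-- The proof is an Ehrenfeucht-Fraïssé argument that counts atoms.  Call two
-- assignments ρ, σ of elements to variables m-equivalent when every term has,
-- counted up to m, as many atoms below its value under ρ as under σ.  The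
-- back-and-forth lemma answers any x, for 2m-equivalent ρ, σ, by a y making
-- (x, ρ) and (y, σ) m-equivalent: by induction on the number of variables
-- both sides are cut along the first variable, down to a single region, where
-- y is assembled from atoms according to how many atoms x cuts off
-- (split-region).  By induction on φ, (bound φ)-equivalent assignments then
-- satisfy the same instances of φ.  Finally, if φ defined Fin, splitting 1
-- gives y with y, 1 - y ∉ Fin, hence both with at least N = bound φ atoms;
-- an x ≤ y with exactly N atoms is in Fin yet N-equivalent to y.
--
-- Excluded middle is used only to decide atom counts and equality
-- to 0.
module Submission where

open import Defs
open import Level using (Level; _⊔_; Lift; lift)
open import Algebra.Lattice.Bundles using (BooleanAlgebra)
open import Axiom.ExcludedMiddle using (ExcludedMiddle)
open import Data.Empty using (⊥-elim)
open import Data.Empty.Polymorphic using (⊥)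
open import Data.Unit.Polymorphic using (⊤) renaming (tt to trivial)
open import Data.Fin using (zero; suc)
open import Data.Nat using (ℕ; zero; suc; _+_; _∸_; _⊓_; _<_; z≤n; s≤s)
  renaming (_≤_ to _≤ℕ_; _⊔_ to _⊔ℕ_)
import Data.Nat.Properties as ℕ
open import Data.Product using (Σ; _×_; _,_; proj₁; proj₂)
open import Data.Product.Function.NonDependent.Propositional using (_×-⇔_)
open import Data.Sum as Sum using (_⊎_; inj₁; inj₂)
open import Data.Sum.Function.Propositional using (_⊎-⇔_)
open import Data.List using (List; []; _∷_; length; take; drop; _++_; tabulate; lookup)
open import Data.List.Properties using (length-++; length-take; length-drop; length-tabulate)
open import Data.List.Membership.Propositional.Properties using (∈-lookup)
open import Data.List.Relation.Unary.All using (All; []; _∷_)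
import Data.List.Relation.Unary.All as All
import Data.List.Relation.Unary.All.Properties as All
open import Data.List.Relation.Unary.Any using (here; there)
open import Data.List.Relation.Unary.AllPairs using ([]; _∷_)
open import Data.List.Relation.Binary.Sublist.Propositional using ([]; _∷_; _∷ʳ_)
  renaming (_⊆_ to _⊑_)
open import Data.List.Relation.Binary.Sublist.Propositional.Properties using (All-resp-⊆)
open import Function.Base using (_∘_)
open import Function.Bundles using (_⇔_; mk⇔; Equivalence)
open import Function.Construct.Identity using (⇔-id)
open import Function.Construct.Symmetry using (⇔-sym)
open import Function.Construct.Composition using (_⇔-∘_)
open import Function.Related.TypeIsomorphisms using (¬-cong-⇔)
open import Relation.Nullary using (¬_; yes; no)
open import Relation.Binary.PropositionalEquality as ≡ using (_≡_; refl)
import Relation.Binary.Lattice as OrderLattice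

-- The order is x ≤ᴮ y
-- (x ∧ y ≈ x) of Defs; it is the library's order x ≈ x ∧ y read backwards, so
-- its laws are the library's up to symmetry of ≈.
module OrderAndAtoms {c ℓ : Level} (B : BooleanAlgebra c ℓ) where
  open BooleanAlgebra B renaming (¬_ to ∼_; ⊤ to 1ᴮ; ⊥ to 0ᴮ)
  open import Algebra.Lattice.Properties.BooleanAlgebra B
  open import Relation.Binary.Reasoning.Setoid setoid
  open import Data.List.Membership.Setoid setoid public using (_∈_; _∉_)
  private
    module Lat = OrderLattice.Lattice ∨-∧-orderTheoreticLattice

  _≤_ : Carrier → Carrier → Set ℓ
  _≤_ = _≤ᴮ_ B

  IsAtom : Carrier → Set (c ⊔ ℓ)
  IsAtom = Atom B

  ≤-trans : ∀ {x y z} → x ≤ y → y ≤ z → x ≤ z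
  ≤-trans p q = sym (Lat.trans (sym p) (sym q))

  ≤-antisym : ∀ {x y} → x ≤ y → y ≤ x → x ≈ y
  ≤-antisym p q = Lat.antisym (sym p) (sym q)

  ≤-respˡ : ∀ {x y z} → x ≈ y → x ≤ z → y ≤ z
  ≤-respˡ x≈y p = sym (Lat.≤-respˡ-≈ x≈y (sym p))

  ≤-respʳ : ∀ {x y z} → y ≈ z → x ≤ y → x ≤ z
  ≤-respʳ y≈z p = sym (Lat.≤-respʳ-≈ y≈z (sym p))

  ∧-lowerˡ : ∀ {x y} → (x ∧ y) ≤ x
  ∧-lowerˡ = sym (Lat.x∧y≤x _ _)

  ∧-lowerʳ : ∀ {x y} → (x ∧ y) ≤ y
  ∧-lowerʳ = sym (Lat.x∧y≤y _ _)

  ∧-greatest : ∀ {z x y} → z ≤ x → z ≤ y → z ≤ (x ∧ y)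
  ∧-greatest p q = sym (Lat.∧-greatest (sym p) (sym q))

  ∨-upperˡ : ∀ {x y} → x ≤ (x ∨ y)
  ∨-upperˡ = sym (Lat.x≤x∨y _ _)

  ∨-upperʳ : ∀ {x y} → y ≤ (x ∨ y)
  ∨-upperʳ = sym (Lat.y≤x∨y _ _)

  ∨-least : ∀ {x y z} → x ≤ z → y ≤ z → (x ∨ y) ≤ z
  ∨-least p q = sym (Lat.∨-least (sym p) (sym q))

  0-least : ∀ {x} → 0ᴮ ≤ x
  0-least = ∧-zeroˡ _

  1-greatest : ∀ {x} → x ≤ 1ᴮ
  1-greatest = ∧-identityʳ _

  ≤0⇒≈0 : ∀ {a} → a ≤ 0ᴮ → a ≈ 0ᴮ
  ≤0⇒≈0 {a} a≤0 = trans (sym a≤0) (∧-zeroʳ a)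

  below-complements : ∀ {a x} → a ≤ x → a ≤ (∼ x) → a ≈ 0ᴮ
  below-complements {a} {x} p q =
    trans (sym (∧-greatest p q)) (trans (∧-congˡ (∧-complementʳ x)) (∧-zeroʳ a))

  difference-0⇒≤ : ∀ {x y} → (x ∧ (∼ y)) ≈ 0ᴮ → x ≤ y
  difference-0⇒≤ {x} {y} h = sym (begin
    x                       ≈⟨ sym (∧-identityʳ x) ⟩
    x ∧ 1ᴮ                  ≈⟨ ∧-congˡ (sym (∨-complementʳ y)) ⟩
    x ∧ (y ∨ (∼ y))         ≈⟨ ∧-distribˡ-∨ x y (∼ y) ⟩
    (x ∧ y) ∨ (x ∧ (∼ y))   ≈⟨ ∨-congˡ h ⟩
    (x ∧ y) ∨ 0ᴮ            ≈⟨ ∨-identityʳ (x ∧ y) ⟩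
    x ∧ y                   ∎)

  atom-nonzero : ∀ {a} → IsAtom a → ¬ (a ≈ 0ᴮ)
  atom-nonzero = proj₁

  atom-split : ∀ {a} x → IsAtom a → (a ≤ x) ⊎ (a ≤ (∼ x))
  atom-split {a} x (_ , minimal) with minimal (a ∧ x) ∧-lowerˡ
  ... | inj₂ a∧x≈a = inj₁ a∧x≈a
  ... | inj₁ a∧x≈0 = inj₂ (difference-0⇒≤ (trans (∧-congˡ (¬-involutive x)) a∧x≈0))

  atom-≤∼⇒≰ : ∀ {a} x → IsAtom a → a ≤ (∼ x) → ¬ (a ≤ x)
  atom-≤∼⇒≰ x at p q = atom-nonzero at (below-complements q p)

  atom-≰⇒≤∼ : ∀ {a} x → IsAtom a → ¬ (a ≤ x) → a ≤ (∼ x)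
  atom-≰⇒≤∼ x at a≰x with atom-split x at
  ... | inj₁ a≤x  = ⊥-elim (a≰x a≤x)
  ... | inj₂ a≤∼x = a≤∼x

  atom-≰∼⇒≤ : ∀ {a} x → IsAtom a → ¬ (a ≤ (∼ x)) → a ≤ x
  atom-≰∼⇒≤ x at a≰∼x with atom-split x at
  ... | inj₁ a≤x  = a≤x
  ... | inj₂ a≤∼x = ⊥-elim (a≰∼x a≤∼x)

  atom-≤∨ : ∀ {a x y} → IsAtom a → a ≤ (x ∨ y) → (a ≤ x) ⊎ (a ≤ y)
  atom-≤∨ {a} {x} {y} at a≤x∨y with atom-split x at | atom-split y at
  ... | inj₁ a≤x | _        = inj₁ a≤x
  ... | inj₂ _   | inj₁ a≤y = inj₂ a≤y
  ... | inj₂ a≤∼x | inj₂ a≤∼y = ⊥-elim (atom-nonzero at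
          (below-complements a≤x∨y (≤-respʳ (sym (deMorgan₂ x y)) (∧-greatest a≤∼x a≤∼y))))

  atom-≤-atom : ∀ {a b} → IsAtom a → IsAtom b → a ≤ b → a ≈ b
  atom-≤-atom at (_ , minimal) a≤b with minimal _ a≤b
  ... | inj₁ a≈0 = ⊥-elim (atom-nonzero at a≈0)
  ... | inj₂ a≈b = a≈b

  ⋁ : List Carrier → Carrier
  ⋁ []      = 0ᴮ
  ⋁ (b ∷ K) = b ∨ ⋁ K

  ⋁-upper : ∀ K → All (_≤ ⋁ K) K
  ⋁-upper []      = []
  ⋁-upper (b ∷ K) = ∨-upperˡ ∷ All.map (λ a≤⋁K → ≤-trans a≤⋁K ∨-upperʳ) (⋁-upper K)

  atom-≤⋁⇒∈ : ∀ {a} K → IsAtom a → All IsAtom K → a ≤ ⋁ K → a ∈ K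
  atom-≤⋁⇒∈ [] at _ a≤0 = ⊥-elim (atom-nonzero at (≤0⇒≈0 a≤0))
  atom-≤⋁⇒∈ (b ∷ K) at (atb ∷ ats) a≤⋁ with atom-≤∨ at a≤⋁
  ... | inj₁ a≤b = here (atom-≤-atom at atb a≤b)
  ... | inj₂ a≤⋁K = there (atom-≤⋁⇒∈ K at ats a≤⋁K)

  ⋁-least : ∀ {s} K → All (_≤ s) K → ⋁ K ≤ s
  ⋁-least []      []       = 0-least
  ⋁-least (b ∷ K) (p ∷ ps) = ∨-least p (⋁-least K ps)

-- Properties of atoms.  Only the values of a property on atoms matter, so
-- properties are compared atomwise; ↓ x is the set of atoms below x.
module AtomPredicates {c ℓ : Level} (B : BooleanAlgebra c ℓ) where
  open BooleanAlgebra B renaming (¬_ to ∼_; ⊤ to 1ᴮ; ⊥ to 0ᴮ)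
  open OrderAndAtoms B

  L : Level
  L = c ⊔ ℓ

  APred : Set (Level.suc L)
  APred = Carrier → Set L

  ∁ₐ : APred → APred
  ∁ₐ P a = ¬ P a

  ↓_ : Carrier → APred
  (↓ x) a = Lift c (a ≤ x)

  _∩ₐ_ _∪ₐ_ _∖ₐ_ : APred → APred → APred
  (P ∩ₐ Q) a = P a × Q a
  (P ∪ₐ Q) a = P a ⊎ Q a
  P ∖ₐ Q = P ∩ₐ ∁ₐ Q

  infix 4 _⊆ₐ_ _≗ₐ_
  infixl 7 _∩ₐ_ _∖ₐ_
  infixl 6 _∪ₐ_
  infix 8 ↓_

  _⊆ₐ_ _≗ₐ_ : APred → APred → Set L
  P ⊆ₐ Q = ∀ a → IsAtom a → P a → Q a
  P ≗ₐ Q = ∀ a → IsAtom a → P a ⇔ Q a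

  ≗ₐ⇒⊆ₐ : ∀ {P Q} → P ≗ₐ Q → P ⊆ₐ Q
  ≗ₐ⇒⊆ₐ e a at = Equivalence.to (e a at)

  ≗ₐ-refl : ∀ {P} → P ≗ₐ P
  ≗ₐ-refl a _ = ⇔-id _

  ≗ₐ-sym : ∀ {P Q} → P ≗ₐ Q → Q ≗ₐ P
  ≗ₐ-sym e a at = ⇔-sym (e a at)

  ≗ₐ-trans : ∀ {P Q R} → P ≗ₐ Q → Q ≗ₐ R → P ≗ₐ R
  ≗ₐ-trans e f a at = f a at ⇔-∘ e a at

  ∩ₐ-cong : ∀ {P P′ Q Q′} → P ≗ₐ P′ → Q ≗ₐ Q′ → P ∩ₐ Q ≗ₐ P′ ∩ₐ Q′
  ∩ₐ-cong e f a at = e a at ×-⇔ f a at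

  ∪ₐ-cong : ∀ {P P′ Q Q′} → P ≗ₐ P′ → Q ≗ₐ Q′ → P ∪ₐ Q ≗ₐ P′ ∪ₐ Q′
  ∪ₐ-cong e f a at = e a at ⊎-⇔ f a at

  ∁ₐ-cong : ∀ {P P′} → P ≗ₐ P′ → ∁ₐ P ≗ₐ ∁ₐ P′
  ∁ₐ-cong e a at = ¬-cong-⇔ (e a at)

  Apart : APred → APred → Set L
  Apart P Q = ∀ a b → IsAtom a → IsAtom b → P a → Q b → ¬ (a ≈ b)

  Apart-sym : ∀ {P Q} → Apart P Q → Apart Q P
  Apart-sym apart a b ata atb q p a≈b = apart b a atb ata p q (sym a≈b)

  ↓-apart : ∀ {z P} → Apart (↓ z) (P ∖ₐ ↓ z)
  ↓-apart a b _ _ (lift a≤z) (_ , b≰z) a≈b = b≰z (lift (≤-respˡ a≈b a≤z))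

  ↓-∧ : ∀ {x y} → ↓ (x ∧ y) ≗ₐ ↓ x ∩ₐ ↓ y
  ↓-∧ a _ = mk⇔ (λ (lift a≤x∧y) → lift (≤-trans a≤x∧y ∧-lowerˡ) , lift (≤-trans a≤x∧y ∧-lowerʳ))
                (λ (lift a≤x , lift a≤y) → lift (∧-greatest a≤x a≤y))

  ↓-∨ : ∀ {x y} → ↓ (x ∨ y) ≗ₐ ↓ x ∪ₐ ↓ y
  ↓-∨ a at = mk⇔ (λ (lift a≤x∨y) → Sum.map lift lift (atom-≤∨ at a≤x∨y))
                 (λ { (inj₁ (lift a≤x)) → lift (≤-trans a≤x ∨-upperˡ)
                    ; (inj₂ (lift a≤y)) → lift (≤-trans a≤y ∨-upperʳ) })

  ↓-∼ : ∀ {x} → ↓ (∼ x) ≗ₐ ∁ₐ (↓ x)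
  ↓-∼ {x} a at = mk⇔ (λ (lift a≤∼x) (lift a≤x) → atom-≤∼⇒≰ x at a≤∼x a≤x)
                     (λ a≰x → lift (atom-≰⇒≤∼ x at (λ a≤x → a≰x (lift a≤x))))

  ↓-difference : ∀ {x y} → ↓ (x ∧ (∼ y)) ≗ₐ ↓ x ∖ₐ ↓ y
  ↓-difference = ≗ₐ-trans ↓-∧ (∩ₐ-cong ≗ₐ-refl ↓-∼)

  ↓-outside-difference : ∀ {s z} → z ≤ s → ↓ s ∖ₐ ↓ (s ∧ (∼ z)) ≗ₐ ↓ z
  ↓-outside-difference {s} {z} z≤s a at = mk⇔
    (λ (lift a≤s , a≰s-z) → lift (atom-≰∼⇒≤ z at (λ a≤∼z → a≰s-z (lift (∧-greatest a≤s a≤∼z)))))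
    (λ (lift a≤z) → lift (≤-trans a≤z z≤s) ,
                    λ (lift a≤s-z) → atom-≤∼⇒≰ z at (≤-trans a≤s-z ∧-lowerʳ) a≤z)

module Counting {c ℓ : Level} (B : BooleanAlgebra c ℓ) where
  open BooleanAlgebra B using (Carrier; _≈_; setoid; sym; trans) renaming (⊥ to 0ᴮ)
  open OrderAndAtoms B
  open AtomPredicates B
  open import Data.List.Relation.Unary.Unique.Setoid setoid using (Unique)
  import Data.List.Relation.Unary.Unique.Setoid.Properties as Unique

  AtomIn : APred → APred
  AtomIn P a = IsAtom a × P a

  record HasAtoms (j : ℕ) (P : APred) : Set L where
    constructor listing
    field
      atoms    : List Carrier
      size     : length atoms ≡ j
      valid    : All (AtomIn P) atoms
      distinct : Unique atoms

  Exactly : ℕ → APred → Set L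
  Exactly k P = HasAtoms k P × ¬ HasAtoms (suc k) P

  Agree : ℕ → APred → APred → Set L
  Agree m P Q = ∀ j → j ≤ℕ m → (HasAtoms j P → HasAtoms j Q) × (HasAtoms j Q → HasAtoms j P)

  HasAtoms-⊆ : ∀ {j P Q} → P ⊆ₐ Q → HasAtoms j P → HasAtoms j Q
  HasAtoms-⊆ P⊆Q (listing K n v u) = listing K n (All.map (λ (at , p) → at , P⊆Q _ at p) v) u

  HasAtoms-≤ : ∀ {j m P} → j ≤ℕ m → HasAtoms m P → HasAtoms j P
  HasAtoms-≤ {j} j≤m (listing K refl v u) =
    listing (take j K) (≡.trans (length-take j K) (ℕ.m≤n⇒m⊓n≡m j≤m)) (All.take⁺ j v) (Unique.take⁺ setoid j u)

  HasAtoms-∪ : ∀ {i j P Q} → Apart P Q → HasAtoms i P → HasAtoms j Q → HasAtoms (i + j) (P ∪ₐ Q)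
  HasAtoms-∪ apart (listing K₁ refl v₁ u₁) (listing K₂ refl v₂ u₂) =
    listing (K₁ ++ K₂) (length-++ K₁)
      (All.++⁺ (All.map (λ (at , p) → at , inj₁ p) v₁) (All.map (λ (at , q) → at , inj₂ q) v₂))
      (Unique.++⁺ setoid u₁ u₂ disjoint)
    where
      disjoint : ∀ {v} → ¬ (v ∈ K₁ × v ∈ K₂)
      disjoint (v∈K₁ , v∈K₂) with All.lookupAny v₁ v∈K₁ | All.lookupAny v₂ v∈K₂
      ... | (ata , p) , v≈a | (atb , q) , v≈b = apart _ _ ata atb p q (trans (sym v≈a) v≈b)

  Unique-⊑ : ∀ {K′ K} → K′ ⊑ K → Unique K → Unique K′
  Unique-⊑ []              []          = []
  Unique-⊑ (_ ∷ʳ K′⊑K)     (_ ∷ u)     = Unique-⊑ K′⊑K u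
  Unique-⊑ (refl ∷ K′⊑K)   (a∉K ∷ u)   = All-resp-⊆ K′⊑K a∉K ∷ Unique-⊑ K′⊑K u

  record Partition (P Q : APred) (K : List Carrier) : Set L where
    constructor parts
    field
      left right : List Carrier
      left⊑       : left ⊑ K
      right⊑      : right ⊑ K
      left-valid  : All (AtomIn P) left
      right-valid : All (AtomIn Q) right
      sizes       : length left + length right ≡ length K

  partition : ∀ {P Q} K → All (AtomIn (P ∪ₐ Q)) K → Partition P Q K
  partition [] [] = parts [] [] [] [] [] [] refl
  partition (a ∷ K) ((at , inj₁ p) ∷ v) with partition K v
  ... | parts K₁ K₂ s₁ s₂ v₁ v₂ n = parts (a ∷ K₁) K₂ (refl ∷ s₁) (a ∷ʳ s₂) ((at , p) ∷ v₁) v₂ (≡.cong suc n)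
  partition (a ∷ K) ((at , inj₂ q) ∷ v) with partition K v
  ... | parts K₁ K₂ s₁ s₂ v₁ v₂ n =
    parts K₁ (a ∷ K₂) (a ∷ʳ s₁) (refl ∷ s₂) v₁ ((at , q) ∷ v₂) (≡.trans (ℕ.+-suc _ _) (≡.cong suc n))

  HasAtoms-∪⁻ : ∀ {j P Q} → HasAtoms j (P ∪ₐ Q) →
    Σ ℕ λ i → Σ ℕ λ k → (i + k ≡ j) × HasAtoms i P × HasAtoms k Q
  HasAtoms-∪⁻ (listing K refl v u) with partition K v
  ... | parts K₁ K₂ s₁ s₂ v₁ v₂ n =
    length K₁ , length K₂ , n , listing K₁ refl v₁ (Unique-⊑ s₁ u) , listing K₂ refl v₂ (Unique-⊑ s₂ u)

  Agree-resp : ∀ {m P P′ Q Q′} → P ≗ₐ P′ → Q ≗ₐ Q′ → Agree m P Q → Agree m P′ Q′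
  Agree-resp eP eQ agree j j≤m =
    (λ h → HasAtoms-⊆ (≗ₐ⇒⊆ₐ eQ) (proj₁ (agree j j≤m) (HasAtoms-⊆ (≗ₐ⇒⊆ₐ (≗ₐ-sym eP)) h))) ,
    (λ h → HasAtoms-⊆ (≗ₐ⇒⊆ₐ eP) (proj₂ (agree j j≤m) (HasAtoms-⊆ (≗ₐ⇒⊆ₐ (≗ₐ-sym eQ)) h)))

  Agree-refl : ∀ {m P} → Agree m P P
  Agree-refl j _ = (λ h → h) , (λ h → h)

  Agree-sym : ∀ {m P Q} → Agree m P Q → Agree m Q P
  Agree-sym agree j j≤m = proj₂ (agree j j≤m) , proj₁ (agree j j≤m)

  Agree-≤ : ∀ {m m′ P Q} → m′ ≤ℕ m → Agree m P Q → Agree m′ P Q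
  Agree-≤ m′≤m agree j j≤m′ = agree j (ℕ.≤-trans j≤m′ m′≤m)

  agree-many : ∀ {m P Q} → HasAtoms m P → HasAtoms m Q → Agree m P Q
  agree-many hP hQ j j≤m = (λ _ → HasAtoms-≤ j≤m hQ) , (λ _ → HasAtoms-≤ j≤m hP)

  exactly-bound : ∀ {j k P} → Exactly k P → HasAtoms j P → j ≤ℕ k
  exactly-bound {j} {k} (_ , no-more) h with j ℕ.≤? k
  ... | yes j≤k = j≤k
  ... | no  j≰k = ⊥-elim (no-more (HasAtoms-≤ (ℕ.≰⇒> j≰k) h))

  agree-exactly : ∀ {m k P Q} → Exactly k P → Exactly k Q → Agree m P Q
  agree-exactly eP eQ j _ = (λ h → HasAtoms-≤ (exactly-bound eP h) (proj₁ eQ)) ,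
                            (λ h → HasAtoms-≤ (exactly-bound eQ h) (proj₁ eP))

  Exactly-resp : ∀ {k P Q} → P ≗ₐ Q → Exactly k P → Exactly k Q
  Exactly-resp e (h , no-more) = HasAtoms-⊆ (≗ₐ⇒⊆ₐ e) h , λ h′ → no-more (HasAtoms-⊆ (≗ₐ⇒⊆ₐ (≗ₐ-sym e)) h′)

  Agree-∪ : ∀ {m P₁ P₂ Q₁ Q₂} → Apart P₁ P₂ → Apart Q₁ Q₂ →
    Agree m P₁ Q₁ → Agree m P₂ Q₂ → Agree m (P₁ ∪ₐ P₂) (Q₁ ∪ₐ Q₂)
  Agree-∪ {m} apartP apartQ agree₁ agree₂ j j≤m =
    transfer apartQ agree₁ agree₂ j j≤m , transfer apartP (Agree-sym agree₁) (Agree-sym agree₂) j j≤m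
    where
      transfer : ∀ {P₁ P₂ Q₁ Q₂} → Apart Q₁ Q₂ → Agree m P₁ Q₁ → Agree m P₂ Q₂ →
        ∀ j → j ≤ℕ m → HasAtoms j (P₁ ∪ₐ P₂) → HasAtoms j (Q₁ ∪ₐ Q₂)
      transfer apart a₁ a₂ j j≤m h with HasAtoms-∪⁻ h
      ... | i , k , refl , h₁ , h₂ =
        HasAtoms-∪ apart (proj₁ (a₁ i (ℕ.≤-trans (ℕ.m≤m+n i k) j≤m)) h₁)
                         (proj₁ (a₂ k (ℕ.≤-trans (ℕ.m≤n+m k i) j≤m)) h₂)

  ∪-bound : ∀ {i k P Q} → Exactly i P → Exactly k Q → ¬ HasAtoms (suc (i + k)) (P ∪ₐ Q)
  ∪-bound {i} {k} eP eQ h with HasAtoms-∪⁻ h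
  ... | i′ , k′ , i′+k′≡ , hP , hQ = ℕ.1+n≰n (≡.subst (_≤ℕ i + k) i′+k′≡
          (ℕ.+-mono-≤ (exactly-bound eP hP) (exactly-bound eQ hQ)))

  remove : ∀ {a} K → a ∈ K → List Carrier
  remove (_ ∷ K) (here _)    = K
  remove (b ∷ K) (there a∈K) = b ∷ remove K a∈K

  remove-length : ∀ {a} K (a∈K : a ∈ K) → suc (length (remove K a∈K)) ≡ length K
  remove-length (_ ∷ K) (here _)    = refl
  remove-length (_ ∷ K) (there a∈K) = ≡.cong suc (remove-length K a∈K)

  remove-keeps : ∀ {a b} K (a∈K : a ∈ K) → b ∈ K → ¬ (a ≈ b) → b ∈ remove K a∈K
  remove-keeps (_ ∷ K) (here a≈k)  (here b≈k)  a≉b = ⊥-elim (a≉b (trans a≈k (sym b≈k)))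
  remove-keeps (_ ∷ K) (here _)    (there b∈K) _   = b∈K
  remove-keeps (_ ∷ K) (there _)   (here b≈k)  _   = here b≈k
  remove-keeps (_ ∷ K) (there a∈K) (there b∈K) a≉b = there (remove-keeps K a∈K b∈K a≉b)

  unique-⊆-length : ∀ K′ K → Unique K′ → All (_∈ K) K′ → length K′ ≤ℕ length K
  unique-⊆-length []       K _           _               = z≤n
  unique-⊆-length (a ∷ K′) K (a∉K′ ∷ u) (a∈K ∷ K′⊆K) =
    ℕ.≤-trans (s≤s (unique-⊆-length K′ (remove K a∈K) u
                 (All.zipWith (λ (b∈K , a≉b) → remove-keeps K a∈K b∈K a≉b) (K′⊆K , a∉K′))))
              (ℕ.≤-reflexive (remove-length K a∈K))

  ⋁-exactly : ∀ K → All IsAtom K → Unique K → Exactly (length K) (↓ ⋁ K)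
  ⋁-exactly K atoms u =
    listing K refl (All.zipWith (λ (at , a≤⋁K) → at , lift a≤⋁K) (atoms , ⋁-upper K)) u ,
    λ (listing K′ size v u′) → ℕ.1+n≰n (≡.subst (_≤ℕ length K) size (unique-⊆-length K′ K u′
      (All.map (λ (at , lift a≤⋁K) → atom-≤⋁⇒∈ K at atoms a≤⋁K) v)))

  take-drop-apart : ∀ p K → Unique K → All (_∉ take p K) (drop p K)
  take-drop-apart zero    K       _          = All.universal (λ _ ()) K
  take-drop-apart (suc p) []      _          = []
  take-drop-apart (suc p) (a ∷ K) (a∉K ∷ u) =
    All.zipWith (λ (a≉b , b∉K₁) → λ { (here b≈a) → a≉b (sym b≈a) ; (there b∈K₁) → b∉K₁ b∈K₁ })
      (All.drop⁺ p a∉K , take-drop-apart p K u)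

  carve : ∀ p q {s} → HasAtoms (p + q) (↓ s) →
    Σ Carrier λ z → z ≤ s × Exactly p (↓ z) × HasAtoms q (↓ s ∖ₐ ↓ z)
  carve p q {s} (listing K size v u) =
    ⋁ K₁ , ⋁-least K₁ (All.map (λ (_ , lift a≤s) → a≤s) v₁) ,
    ≡.subst (λ k → Exactly k (↓ ⋁ K₁)) |K₁| (⋁-exactly K₁ atoms₁ (Unique.take⁺ setoid p u)) ,
    listing K₂ |K₂| (All.zipWith outside (All.drop⁺ p v , take-drop-apart p K u)) (Unique.drop⁺ setoid p u)
    where
      K₁ K₂ : List Carrier
      K₁ = take p K
      K₂ = drop p K
      v₁ : All (AtomIn (↓ s)) K₁
      v₁ = All.take⁺ p v
      atoms₁ : All IsAtom K₁
      atoms₁ = All.map proj₁ v₁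
      |K₁| : length K₁ ≡ p
      |K₁| = ≡.trans (length-take p K) (≡.trans (≡.cong (p ⊓_) size) (ℕ.m≤n⇒m⊓n≡m (ℕ.m≤m+n p q)))
      |K₂| : length K₂ ≡ q
      |K₂| = ≡.trans (length-drop p K) (≡.trans (≡.cong (_∸ p) size) (ℕ.m+n∸m≡n p q))
      outside : ∀ {b} → AtomIn (↓ s) b × b ∉ K₁ → AtomIn (↓ s ∖ₐ ↓ ⋁ K₁) b
      outside ((at , b≤s) , b∉K₁) = at , b≤s , λ (lift b≤⋁) → b∉K₁ (atom-≤⋁⇒∈ K₁ at atoms₁ b≤⋁)

  unique-lookup-injective : ∀ K → Unique K → ∀ i j → lookup K i ≈ lookup K j → i ≡ j
  unique-lookup-injective (_ ∷ K) _          zero    zero    _ = refl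
  unique-lookup-injective (_ ∷ K) (a∉K ∷ _) zero    (suc j) e = ⊥-elim (All.lookup a∉K (∈-lookup j) e)
  unique-lookup-injective (_ ∷ K) (a∉K ∷ _) (suc i) zero    e = ⊥-elim (All.lookup a∉K (∈-lookup i) (sym e))
  unique-lookup-injective (_ ∷ K) (_ ∷ u)   (suc i) (suc j) e = ≡.cong suc (unique-lookup-injective K u i j e)

  AtLeastAtoms⇒HasAtoms : ∀ {n x} → AtLeastAtoms B n x → HasAtoms n (↓ x)
  AtLeastAtoms⇒HasAtoms (f , valid , injective) =
    listing (tabulate f) (length-tabulate f)
      (All.tabulate⁺ (λ i → proj₁ (valid i) , lift (proj₂ (valid i))))
      (Unique.tabulate⁺ setoid (injective _ _))

  HasAtoms⇒AtLeastAtoms : ∀ {n x} → HasAtoms n (↓ x) → AtLeastAtoms B n x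
  HasAtoms⇒AtLeastAtoms (listing K refl v u) =
    lookup K , (λ i → let (at , lift a≤x) = All.lookup v (∈-lookup i) in at , a≤x) ,
    unique-lookup-injective K u

  zero-has-no-atoms : ∀ {x} → x ≈ 0ᴮ → ¬ HasAtoms 1 (↓ x)
  zero-has-no-atoms x≈0 (listing (a ∷ _) _ ((at , lift a≤x) ∷ _) _) =
    atom-nonzero at (≤0⇒≈0 (≤-respʳ x≈0 a≤x))

  module _ (em : ExcludedMiddle L) where

    size-cases : ∀ m P → HasAtoms m P ⊎ Σ ℕ λ k → k < m × Exactly k P
    size-cases zero    P = inj₁ (listing [] refl [] [])
    size-cases (suc m) P with size-cases m P
    ... | inj₂ (k , k<m , e) = inj₂ (k , ℕ.m≤n⇒m≤1+n k<m , e)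
    ... | inj₁ h with em {HasAtoms (suc m) P}
    ...   | yes h′  = inj₁ h′
    ...   | no  ¬h′ = inj₂ (m , ℕ.≤-refl , h , ¬h′)

    no-atoms⇒0 : Atomic B → ∀ {x} → ¬ HasAtoms 1 (↓ x) → x ≈ 0ᴮ
    no-atoms⇒0 atomic {x} no-atom with em {Lift c (x ≈ 0ᴮ)}
    ... | yes (lift x≈0) = x≈0
    ... | no  x≉0 =
      let (a , at , a≤x) = atomic x (λ x≈0 → x≉0 (lift x≈0))
      in ⊥-elim (no-atom (listing (a ∷ []) refl ((at , lift a≤x) ∷ []) ([] ∷ [])))

module Similarity {c ℓ : Level} (B : BooleanAlgebra c ℓ) where
  open BooleanAlgebra B using (Carrier; _∧_) renaming (¬_ to ∼_; ⊤ to 1ᴮ)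
  open OrderAndAtoms B
  open AtomPredicates B
  open Counting B

  -- the atoms below the value of a term, computed compositionally so that
  -- weakening and substitution act on it by structural recursion
  ⟦_⟧ᵃ : ∀ {n} → Term n → Env B n → APred
  ⟦ var i ⟧ᵃ ρ   = ↓ ρ i
  ⟦ 𝟘 ⟧ᵃ ρ _     = ⊥
  ⟦ 𝟙 ⟧ᵃ ρ _     = ⊤
  ⟦ s ∩ t ⟧ᵃ ρ   = ⟦ s ⟧ᵃ ρ ∩ₐ ⟦ t ⟧ᵃ ρ
  ⟦ s ∪ t ⟧ᵃ ρ   = ⟦ s ⟧ᵃ ρ ∪ₐ ⟦ t ⟧ᵃ ρ
  ⟦ ∁ t ⟧ᵃ ρ     = ∁ₐ (⟦ t ⟧ᵃ ρ)

  ⟦⟧ᵃ-correct : ∀ {n} (t : Term n) ρ → ⟦ t ⟧ᵃ ρ ≗ₐ ↓ (⟦_⟧ₜ B t ρ)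
  ⟦⟧ᵃ-correct (var i) ρ = ≗ₐ-refl
  ⟦⟧ᵃ-correct 𝟘       ρ a at = mk⇔ (λ ()) (λ (lift a≤0) → ⊥-elim (atom-nonzero at (≤0⇒≈0 a≤0)))
  ⟦⟧ᵃ-correct 𝟙       ρ a at = mk⇔ (λ _ → lift 1-greatest) (λ _ → trivial)
  ⟦⟧ᵃ-correct (s ∩ t) ρ = ≗ₐ-trans (∩ₐ-cong (⟦⟧ᵃ-correct s ρ) (⟦⟧ᵃ-correct t ρ)) (≗ₐ-sym ↓-∧)
  ⟦⟧ᵃ-correct (s ∪ t) ρ = ≗ₐ-trans (∪ₐ-cong (⟦⟧ᵃ-correct s ρ) (⟦⟧ᵃ-correct t ρ)) (≗ₐ-sym ↓-∨)
  ⟦⟧ᵃ-correct (∁ t)   ρ = ≗ₐ-trans (∁ₐ-cong (⟦⟧ᵃ-correct t ρ)) (≗ₐ-sym ↓-∼)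

  tail : ∀ {n} → Env B (suc n) → Env B n
  tail ρ i = ρ (suc i)

  wk : ∀ {n} → Term n → Term (suc n)
  wk (var i) = var (suc i)
  wk 𝟘       = 𝟘
  wk 𝟙       = 𝟙
  wk (s ∩ t) = wk s ∩ wk t
  wk (s ∪ t) = wk s ∪ wk t
  wk (∁ t)   = ∁ wk t

  wk-atom : ∀ {n} (t : Term n) ρ a → ⟦ wk t ⟧ᵃ ρ a ⇔ ⟦ t ⟧ᵃ (tail ρ) a
  wk-atom (var i) ρ a = ⇔-id _
  wk-atom 𝟘       ρ a = ⇔-id _
  wk-atom 𝟙       ρ a = ⇔-id _
  wk-atom (s ∩ t) ρ a = wk-atom s ρ a ×-⇔ wk-atom t ρ a
  wk-atom (s ∪ t) ρ a = wk-atom s ρ a ⊎-⇔ wk-atom t ρ a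
  wk-atom (∁ t)   ρ a = ¬-cong-⇔ (wk-atom t ρ a)

  _[_]₀ : ∀ {n} → Term (suc n) → Term n → Term n
  var zero    [ c ]₀ = c
  var (suc i) [ c ]₀ = var i
  𝟘           [ c ]₀ = 𝟘
  𝟙           [ c ]₀ = 𝟙
  (s ∩ t)     [ c ]₀ = (s [ c ]₀) ∩ (t [ c ]₀)
  (s ∪ t)     [ c ]₀ = (s [ c ]₀) ∪ (t [ c ]₀)
  (∁ t)       [ c ]₀ = ∁ (t [ c ]₀)

  subst₀-atom : ∀ {n} (u : Term (suc n)) c ρ a → ⟦ var zero ⟧ᵃ ρ a ⇔ ⟦ c ⟧ᵃ (tail ρ) a →
    ⟦ u ⟧ᵃ ρ a ⇔ ⟦ u [ c ]₀ ⟧ᵃ (tail ρ) a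
  subst₀-atom (var zero)    c ρ a e = e
  subst₀-atom (var (suc i)) c ρ a e = ⇔-id _
  subst₀-atom 𝟘             c ρ a e = ⇔-id _
  subst₀-atom 𝟙             c ρ a e = ⇔-id _
  subst₀-atom (s ∩ t)       c ρ a e = subst₀-atom s c ρ a e ×-⇔ subst₀-atom t c ρ a e
  subst₀-atom (s ∪ t)       c ρ a e = subst₀-atom s c ρ a e ⊎-⇔ subst₀-atom t c ρ a e
  subst₀-atom (∁ t)         c ρ a e = ¬-cong-⇔ (subst₀-atom t c ρ a e)

  Similar : ∀ {n} → ℕ → APred → Env B n → APred → Env B n → Set L
  Similar m P ρ Q σ = ∀ t → Agree m (P ∩ₐ ⟦ t ⟧ᵃ ρ) (Q ∩ₐ ⟦ t ⟧ᵃ σ)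

  Similar-resp : ∀ {n m P P′ Q Q′} {ρ σ : Env B n} → P ≗ₐ P′ → Q ≗ₐ Q′ →
    Similar m P ρ Q σ → Similar m P′ ρ Q′ σ
  Similar-resp eP eQ sim t = Agree-resp (∩ₐ-cong eP ≗ₐ-refl) (∩ₐ-cong eQ ≗ₐ-refl) (sim t)

  Similar-sym : ∀ {n m P Q} {ρ σ : Env B n} → Similar m P ρ Q σ → Similar m Q σ P ρ
  Similar-sym sim t = Agree-sym (sim t)

  Similar-≤ : ∀ {n m m′ P Q} {ρ σ : Env B n} → m′ ≤ℕ m → Similar m P ρ Q σ → Similar m′ P ρ Q σ
  Similar-≤ m′≤m sim t = Agree-≤ m′≤m (sim t)

  Similar⇒Agree : ∀ {n m P Q} {ρ σ : Env B n} → Similar m P ρ Q σ → Agree m P Q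
  Similar⇒Agree sim = Agree-resp ∩ₐ-⊤ ∩ₐ-⊤ (sim 𝟙)
    where
      ∩ₐ-⊤ : ∀ {P} → P ∩ₐ (λ _ → ⊤) ≗ₐ P
      ∩ₐ-⊤ a _ = mk⇔ proj₁ (λ p → p , trivial)

  closed-term : (t : Term 0) → (∀ ρ a → ⟦ t ⟧ᵃ ρ a) ⊎ (∀ ρ a → ¬ ⟦ t ⟧ᵃ ρ a)
  closed-term 𝟘 = inj₂ (λ _ _ ())
  closed-term 𝟙 = inj₁ (λ _ _ → trivial)
  closed-term (s ∩ t) with closed-term s | closed-term t
  ... | inj₁ all-s | inj₁ all-t = inj₁ (λ ρ a → all-s ρ a , all-t ρ a)
  ... | inj₂ no-s  | _          = inj₂ (λ ρ a (in-s , _) → no-s ρ a in-s)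
  ... | inj₁ _     | inj₂ no-t  = inj₂ (λ ρ a (_ , in-t) → no-t ρ a in-t)
  closed-term (s ∪ t) with closed-term s | closed-term t
  ... | inj₁ all-s | _          = inj₁ (λ ρ a → inj₁ (all-s ρ a))
  ... | inj₂ _     | inj₁ all-t = inj₁ (λ ρ a → inj₂ (all-t ρ a))
  ... | inj₂ no-s  | inj₂ no-t  = inj₂ (λ ρ a → Sum.[ no-s ρ a , no-t ρ a ])
  closed-term (∁ t) with closed-term t
  ... | inj₁ all-t = inj₂ (λ ρ a not-t → not-t (all-t ρ a))
  ... | inj₂ no-t  = inj₁ no-t

  Agree⇒Similar : ∀ {m P Q} → Agree m P Q → (ρ σ : Env B 0) → Similar m P ρ Q σ
  Agree⇒Similar {P = P} {Q} agree ρ σ t with closed-term t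
  ... | inj₁ all  = Agree-resp (λ a _ → mk⇔ (λ p → p , all ρ a) proj₁)
                               (λ a _ → mk⇔ (λ q → q , all σ a) proj₁) agree
  ... | inj₂ none = Agree-resp {P = P ∩ₐ ⟦ t ⟧ᵃ ρ} ≗ₐ-refl
                               (λ a _ → mk⇔ (λ (_ , in-t) → ⊥-elim (none ρ a in-t))
                                            (λ (_ , in-t) → ⊥-elim (none σ a in-t)))
                               Agree-refl

  Similar-split : ∀ {m n P Q} {ρ σ : Env B (suc n)} → Similar m P ρ Q σ →
    Similar m (P ∩ₐ ↓ ρ zero) (tail ρ) (Q ∩ₐ ↓ σ zero) (tail σ) ×
    Similar m (P ∖ₐ ↓ ρ zero) (tail ρ) (Q ∖ₐ ↓ σ zero) (tail σ)
  Similar-split {ρ = ρ} {σ} sim = regroup (var zero) , regroup (∁ var zero)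
    where
      reassoc : ∀ {P} S t (τ : Env B _) → P ∩ₐ (⟦ S ⟧ᵃ τ ∩ₐ ⟦ wk t ⟧ᵃ τ) ≗ₐ P ∩ₐ ⟦ S ⟧ᵃ τ ∩ₐ ⟦ t ⟧ᵃ (tail τ)
      reassoc S t τ a _ = mk⇔ (λ (p , s , w) → (p , s) , Equivalence.to (wk-atom t τ a) w)
                              (λ ((p , s) , w) → p , s , Equivalence.from (wk-atom t τ a) w)
      regroup : ∀ S t → Agree _ (_ ∩ₐ ⟦ S ⟧ᵃ ρ ∩ₐ ⟦ t ⟧ᵃ (tail ρ)) (_ ∩ₐ ⟦ S ⟧ᵃ σ ∩ₐ ⟦ t ⟧ᵃ (tail σ))
      regroup S t = Agree-resp (reassoc S t ρ) (reassoc S t σ) (sim (S ∩ wk t))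

  Similar-join : ∀ {m n P Q} {ρ σ : Env B (suc n)} →
    Similar m (P ∩ₐ ↓ ρ zero) (tail ρ) (Q ∩ₐ ↓ σ zero) (tail σ) →
    Similar m (P ∖ₐ ↓ ρ zero) (tail ρ) (Q ∖ₐ ↓ σ zero) (tail σ) →
    Similar m P ρ Q σ
  Similar-join {P = P} {Q} {ρ} {σ} sim₁ sim₂ u =
    Agree-resp (≗ₐ-sym (cases ρ)) (≗ₐ-sym (cases σ))
      (Agree-∪ cut-apart cut-apart (sim₁ (u [ 𝟙 ]₀)) (sim₂ (u [ 𝟘 ]₀)))
    where
      -- below the first variable it is 𝟙, outside it it is 𝟘
      cases : ∀ {P} τ → P ∩ₐ ⟦ u ⟧ᵃ τ ≗ₐ
        P ∩ₐ ↓ τ zero ∩ₐ ⟦ u [ 𝟙 ]₀ ⟧ᵃ (tail τ) ∪ₐ P ∖ₐ ↓ τ zero ∩ₐ ⟦ u [ 𝟘 ]₀ ⟧ᵃ (tail τ)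
      cases {P} τ a at = mk⇔ split merge
        where
          as-𝟙 : a ≤ τ zero → ⟦ u ⟧ᵃ τ a ⇔ ⟦ u [ 𝟙 ]₀ ⟧ᵃ (tail τ) a
          as-𝟙 a≤z = subst₀-atom u 𝟙 τ a (mk⇔ (λ _ → trivial) (λ _ → lift a≤z))
          as-𝟘 : ∁ₐ (↓ τ zero) a → ⟦ u ⟧ᵃ τ a ⇔ ⟦ u [ 𝟘 ]₀ ⟧ᵃ (tail τ) a
          as-𝟘 a≰z = subst₀-atom u 𝟘 τ a (mk⇔ (λ a≤z → ⊥-elim (a≰z a≤z)) (λ ()))
          split : (P ∩ₐ ⟦ u ⟧ᵃ τ) a →
            (P ∩ₐ ↓ τ zero ∩ₐ ⟦ u [ 𝟙 ]₀ ⟧ᵃ (tail τ) ∪ₐ P ∖ₐ ↓ τ zero ∩ₐ ⟦ u [ 𝟘 ]₀ ⟧ᵃ (tail τ)) a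
          split (p , w) with atom-split (τ zero) at
          ... | inj₁ a≤z  = inj₁ ((p , lift a≤z) , Equivalence.to (as-𝟙 a≤z) w)
          ... | inj₂ a≤∼z = inj₂ ((p , a≰z) , Equivalence.to (as-𝟘 a≰z) w)
            where a≰z = λ (lift a≤z) → atom-≤∼⇒≰ (τ zero) at a≤∼z a≤z
          merge : (P ∩ₐ ↓ τ zero ∩ₐ ⟦ u [ 𝟙 ]₀ ⟧ᵃ (tail τ) ∪ₐ P ∖ₐ ↓ τ zero ∩ₐ ⟦ u [ 𝟘 ]₀ ⟧ᵃ (tail τ)) a →
            (P ∩ₐ ⟦ u ⟧ᵃ τ) a
          merge (inj₁ ((p , lift a≤z) , w)) = p , Equivalence.from (as-𝟙 a≤z) w
          merge (inj₂ ((p , a≰z) , w))      = p , Equivalence.from (as-𝟘 a≰z) w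
      cut-apart : ∀ {P z S T} → Apart (P ∩ₐ ↓ z ∩ₐ S) (P ∖ₐ ↓ z ∩ₐ T)
      cut-apart a b _ _ ((_ , lift a≤z) , _) ((_ , b≰z) , _) a≈b = b≰z (lift (≤-respˡ a≈b a≤z))

  Equivalent : ∀ {n} → ℕ → Env B n → Env B n → Set L
  Equivalent m ρ σ = Similar m (↓ 1ᴮ) ρ (↓ 1ᴮ) σ

  ↓1-∩ : ∀ {P} → P ≗ₐ ↓ 1ᴮ ∩ₐ P
  ↓1-∩ a _ = mk⇔ (λ p → lift 1-greatest , p) proj₂

  Equivalent⇒Agree : ∀ {n m} {ρ σ : Env B n} → Equivalent m ρ σ →
    ∀ t → Agree m (↓ (⟦_⟧ₜ B t ρ)) (↓ (⟦_⟧ₜ B t σ))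
  Equivalent⇒Agree {ρ = ρ} {σ} equiv t =
    Agree-resp (≗ₐ-trans (≗ₐ-sym ↓1-∩) (⟦⟧ᵃ-correct t ρ)) (≗ₐ-trans (≗ₐ-sym ↓1-∩) (⟦⟧ᵃ-correct t σ)) (equiv t)

  single-equivalent : ∀ {m x y} → Agree m (↓ x) (↓ y) → Agree m (↓ (∼ x)) (↓ (∼ y)) →
    Equivalent m (extend B x (λ ())) (extend B y (λ ()))
  single-equivalent agree-in agree-out =
    Similar-join (Agree⇒Similar (Agree-resp ↓1-∩ ↓1-∩ agree-in) _ _)
                 (Agree⇒Similar (Agree-resp (≗ₐ-trans ↓-∼ ↓1-∖) (≗ₐ-trans ↓-∼ ↓1-∖) agree-out) _ _)
    where
      ↓1-∖ : ∀ {P} → ∁ₐ P ≗ₐ ↓ 1ᴮ ∖ₐ P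
      ↓1-∖ a _ = mk⇔ (λ p → lift 1-greatest , p) proj₂

  exact-twin : ∀ {m y} → HasAtoms m (↓ y) → HasAtoms m (↓ (1ᴮ ∧ (∼ y))) →
    Σ Carrier λ x → Exactly m (↓ x) × Equivalent m (extend B x (λ ())) (extend B y (λ ()))
  exact-twin {m} {y} below-y below-1-y =
    let (x , x≤y , x-exact , _) =
          carve m 0 (≡.subst (λ k → HasAtoms k (↓ y)) (≡.sym (ℕ.+-identityʳ m)) below-y)
        below-∼y = HasAtoms-⊆ (λ _ _ (lift a≤1-y) → lift (≤-trans a≤1-y ∧-lowerʳ)) below-1-y
        below-∼x = HasAtoms-⊆ (λ _ at (lift a≤∼y) → lift (atom-≰⇒≤∼ x at λ a≤x →
                     atom-≤∼⇒≰ y at a≤∼y (≤-trans a≤x x≤y))) below-∼y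
    in x , x-exact , single-equivalent (agree-many (proj₁ x-exact) below-y) (agree-many below-∼x below-∼y)

module BackAndForth {c ℓ : Level} (em : ExcludedMiddle (c ⊔ ℓ)) (B : BooleanAlgebra c ℓ) where
  open BooleanAlgebra B using (Carrier; _∧_; _∨_) renaming (¬_ to ∼_; ⊤ to 1ᴮ)
  open OrderAndAtoms B
  open AtomPredicates B
  open Counting B
  open Similarity B

  module OneRegion (m : ℕ) (R : APred) (s x : Carrier) (agree : Agree (m + m) R (↓ s)) where
    X N : APred
    X = R ∩ₐ ↓ x
    N = R ∖ₐ ↓ x

    Answer : Set L
    Answer = Σ Carrier λ y → y ≤ s × Agree m X (↓ y) × Agree m N (↓ s ∖ₐ ↓ y)

    X-N-apart : Apart X N
    X-N-apart a b _ _ (_ , lift a≤x) (_ , b≰x) a≈b = b≰x (lift (≤-respˡ a≈b a≤x))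

    R⊆X∪N : R ⊆ₐ X ∪ₐ N
    R⊆X∪N a at r with atom-split x at
    ... | inj₁ a≤x  = inj₁ (r , lift a≤x)
    ... | inj₂ a≤∼x = inj₂ (r , λ (lift a≤x) → atom-≤∼⇒≰ x at a≤∼x a≤x)

    into-s : ∀ {j P Q} → j ≤ℕ m + m → (∀ {a} → P a ⊎ Q a → R a) → HasAtoms j (P ∪ₐ Q) → HasAtoms j (↓ s)
    into-s j≤2m ⊆R h = proj₁ (agree _ j≤2m) (HasAtoms-⊆ (λ _ _ → ⊆R) h)

    X∪N⊆R : ∀ {a} → X a ⊎ N a → R a
    X∪N⊆R = Sum.[ proj₁ , proj₁ ]

    N∪X⊆R : ∀ {a} → N a ⊎ X a → R a
    N∪X⊆R = Sum.[ proj₁ , proj₁ ]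

    -- at least m atoms on both sides: take y with exactly m atoms
    many-in-many-out : HasAtoms m X → HasAtoms m N → Answer
    many-in-many-out hX hN =
      let (z , z≤s , ez , hz) = carve m m (into-s ℕ.≤-refl X∪N⊆R (HasAtoms-∪ X-N-apart hX hN))
      in z , z≤s , agree-many hX (proj₁ ez) , agree-many hN hz

    -- k < m atoms in X: take y with exactly k atoms
    few-in-many-out : ∀ {k} → k < m → Exactly k X → HasAtoms m N → Answer
    few-in-many-out k<m eX hN =
      let (z , z≤s , ez , hz) = carve _ m (into-s (ℕ.+-mono-≤ (ℕ.<⇒≤ k<m) ℕ.≤-refl) X∪N⊆R
                                  (HasAtoms-∪ X-N-apart (proj₁ eX) hN))
      in z , z≤s , agree-exactly eX ez , agree-many hN hz

    -- k < m atoms in N: take y = s - z with z exactly k atoms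
    many-in-few-out : ∀ {k} → k < m → HasAtoms m X → Exactly k N → Answer
    many-in-few-out k<m hX eN =
      let (z , z≤s , ez , hz) = carve _ m (into-s (ℕ.+-mono-≤ (ℕ.<⇒≤ k<m) ℕ.≤-refl) N∪X⊆R
                                  (HasAtoms-∪ (Apart-sym X-N-apart) (proj₁ eN) hX))
      in s ∧ (∼ z) , ∧-lowerˡ , agree-many hX (HasAtoms-⊆ (≗ₐ⇒⊆ₐ (≗ₐ-sym ↓-difference)) hz) ,
         agree-exactly eN (Exactly-resp (≗ₐ-sym (↓-outside-difference z≤s)) ez)

    -- with exactly k₁ and k₂ atoms in X and N, R and hence ↓ s have at most
    -- k₁ + k₂, so outside a z ≤ s with exactly k₁ atoms there are at most k₂
    rest-bound : ∀ {k₁ k₂ z} → k₁ < m → k₂ < m → Exactly k₁ X → Exactly k₂ N → z ≤ s →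
      Exactly k₁ (↓ z) → ¬ HasAtoms (suc k₂) (↓ s ∖ₐ ↓ z)
    rest-bound {k₁} {k₂} {z} k₁<m k₂<m eX eN z≤s ez h =
      ∪-bound eX eN (HasAtoms-⊆ R⊆X∪N (proj₂ (agree _ (ℕ.+-mono-≤ k₁<m (ℕ.<⇒≤ k₂<m)))
        (HasAtoms-⊆ z∪rest⊆s (≡.subst (λ j → HasAtoms j (↓ z ∪ₐ (↓ s ∖ₐ ↓ z))) (ℕ.+-suc k₁ k₂)
          (HasAtoms-∪ ↓-apart (proj₁ ez) h)))))
      where
        z∪rest⊆s : ↓ z ∪ₐ (↓ s ∖ₐ ↓ z) ⊆ₐ ↓ s
        z∪rest⊆s _ _ (inj₁ (lift a≤z)) = lift (≤-trans a≤z z≤s)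
        z∪rest⊆s _ _ (inj₂ (a≤s , _))  = a≤s

    -- exactly k₁, k₂ < m atoms in X and N: take y with exactly k₁ atoms
    few-in-few-out : ∀ {k₁ k₂} → k₁ < m → k₂ < m → Exactly k₁ X → Exactly k₂ N → Answer
    few-in-few-out k₁<m k₂<m eX eN =
      let (z , z≤s , ez , hz) = carve _ _ (into-s (ℕ.+-mono-≤ (ℕ.<⇒≤ k₁<m) (ℕ.<⇒≤ k₂<m)) X∪N⊆R
                                  (HasAtoms-∪ X-N-apart (proj₁ eX) (proj₁ eN)))
      in z , z≤s , agree-exactly eX ez , agree-exactly eN (hz , rest-bound k₁<m k₂<m eX eN z≤s ez)

    answer : Answer
    answer with size-cases em m X | size-cases em m N
    ... | inj₁ hX              | inj₁ hN              = many-in-many-out hX hN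
    ... | inj₂ (_ , k<m , eX)  | inj₁ hN              = few-in-many-out k<m eX hN
    ... | inj₁ hX              | inj₂ (_ , k<m , eN)  = many-in-few-out k<m hX eN
    ... | inj₂ (_ , k₁<m , eX) | inj₂ (_ , k₂<m , eN) = few-in-few-out k₁<m k₂<m eX eN

  split-region : ∀ m R s x → Agree (m + m) R (↓ s) →
    Σ Carrier λ y → y ≤ s × Agree m (R ∩ₐ ↓ x) (↓ y) × Agree m (R ∖ₐ ↓ x) (↓ s ∖ₐ ↓ y)
  split-region = OneRegion.answer

  ∩ₐ-swap : ∀ {R S T} → R ∩ₐ S ∩ₐ T ≗ₐ R ∩ₐ T ∩ₐ S
  ∩ₐ-swap a _ = mk⇔ (λ ((r , s) , t) → (r , t) , s) (λ ((r , t) , s) → (r , s) , t)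

  join-of-cuts : ∀ {s z y₁ y₂} → y₁ ≤ (s ∧ z) → y₂ ≤ (s ∧ (∼ z)) →
    (↓ y₁ ≗ₐ ↓ (y₁ ∨ y₂) ∩ₐ ↓ z) × (↓ y₂ ≗ₐ ↓ (y₁ ∨ y₂) ∖ₐ ↓ z) ×
    (↓ (s ∧ z) ∖ₐ ↓ y₁ ≗ₐ ↓ s ∖ₐ ↓ (y₁ ∨ y₂) ∩ₐ ↓ z) ×
    (↓ (s ∧ (∼ z)) ∖ₐ ↓ y₂ ≗ₐ ↓ s ∖ₐ ↓ (y₁ ∨ y₂) ∖ₐ ↓ z)
  join-of-cuts {s} {z} {y₁} {y₂} y₁≤ y₂≤ =
    (λ a at → mk⇔ (λ (lift a≤y₁) → lift (≤-trans a≤y₁ ∨-upperˡ) , lift (≤-trans a≤y₁ y₁≤z))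
                  (λ (lift a≤y , lift a≤z) → lift (Equivalence.to (inside at a≤z) a≤y))) ,
    (λ a at → mk⇔ (λ (lift a≤y₂) → lift (≤-trans a≤y₂ ∨-upperʳ) , off-z at (≤-trans a≤y₂ y₂≤))
                  (λ (lift a≤y , a≰z) → lift (Equivalence.to (outside at a≰z) a≤y))) ,
    (λ a at → mk⇔ (λ (lift a≤s∧z , a≰y₁) → (lift (≤-trans a≤s∧z ∧-lowerˡ) ,
                      λ (lift a≤y) → a≰y₁ (lift (Equivalence.to (inside at (≤-trans a≤s∧z ∧-lowerʳ)) a≤y))) ,
                    lift (≤-trans a≤s∧z ∧-lowerʳ))
                  (λ ((lift a≤s , a≰y) , lift a≤z) → lift (∧-greatest a≤s a≤z) ,
                      λ (lift a≤y₁) → a≰y (lift (≤-trans a≤y₁ ∨-upperˡ)))) ,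
    (λ a at → mk⇔ (λ (lift a≤s-z , a≰y₂) → (lift (≤-trans a≤s-z ∧-lowerˡ) ,
                      λ (lift a≤y) → a≰y₂ (lift (Equivalence.to (outside at (off-z at a≤s-z)) a≤y))) ,
                    off-z at a≤s-z)
                  (λ ((lift a≤s , a≰y) , a≰z) →
                      lift (∧-greatest a≤s (atom-≰⇒≤∼ z at (λ a≤z → a≰z (lift a≤z)))) ,
                      λ (lift a≤y₂) → a≰y (lift (≤-trans a≤y₂ ∨-upperʳ))))
    where
      y₁≤z : y₁ ≤ z
      y₁≤z = ≤-trans y₁≤ ∧-lowerʳ
      off-z : ∀ {a} → IsAtom a → a ≤ (s ∧ (∼ z)) → ∁ₐ (↓ z) a
      off-z at a≤s-z (lift a≤z) = atom-≤∼⇒≰ z at (≤-trans a≤s-z ∧-lowerʳ) a≤z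
      inside : ∀ {a} → IsAtom a → a ≤ z → (a ≤ (y₁ ∨ y₂)) ⇔ (a ≤ y₁)
      inside at a≤z =
        mk⇔ (λ a≤y → Sum.[ (λ a≤y₁ → a≤y₁) , (λ a≤y₂ → ⊥-elim (off-z at (≤-trans a≤y₂ y₂≤) (lift a≤z))) ]
                           (atom-≤∨ at a≤y))
            (λ a≤y₁ → ≤-trans a≤y₁ ∨-upperˡ)
      outside : ∀ {a} → IsAtom a → ∁ₐ (↓ z) a → (a ≤ (y₁ ∨ y₂)) ⇔ (a ≤ y₂)
      outside at a≰z =
        mk⇔ (λ a≤y → Sum.[ (λ a≤y₁ → ⊥-elim (a≰z (lift (≤-trans a≤y₁ y₁≤z)))) , (λ a≤y₂ → a≤y₂) ]
                           (atom-≤∨ at a≤y))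
            (λ a≤y₂ → ≤-trans a≤y₂ ∨-upperʳ)

  -- By induction on the number of variables, cutting
  -- both sides by the first variable; with no variables left this is
  -- split-region.
  respond : ∀ m {n} (ρ σ : Env B n) R s x → Similar (m + m) R ρ (↓ s) σ →
    Σ Carrier λ y → y ≤ s × Similar m (R ∩ₐ ↓ x) ρ (↓ y) σ × Similar m (R ∖ₐ ↓ x) ρ (↓ s ∖ₐ ↓ y) σ
  respond m {zero} ρ σ R s x sim =
    let (y , y≤s , agree-in , agree-out) = split-region m R s x (Similar⇒Agree sim)
    in y , y≤s , Agree⇒Similar agree-in ρ σ , Agree⇒Similar agree-out ρ σ
  respond m {suc n} ρ σ R s x sim =
    let (sim-in , sim-out) = Similar-split sim
        (y₁ , y₁≤ , in₁ , out₁) = respond m (tail ρ) (tail σ) (R ∩ₐ ↓ ρ zero) (s ∧ σ zero) x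
                                    (Similar-resp ≗ₐ-refl (≗ₐ-sym ↓-∧) sim-in)
        (y₂ , y₂≤ , in₂ , out₂) = respond m (tail ρ) (tail σ) (R ∖ₐ ↓ ρ zero) (s ∧ (∼ σ zero)) x
                                    (Similar-resp ≗ₐ-refl (≗ₐ-sym ↓-difference) sim-out)
        (cut₁ , cut₂ , rest₁ , rest₂) = join-of-cuts y₁≤ y₂≤
    in y₁ ∨ y₂ , ∨-least (≤-trans y₁≤ ∧-lowerˡ) (≤-trans y₂≤ ∧-lowerˡ) ,
       Similar-join (Similar-resp ∩ₐ-swap cut₁ in₁) (Similar-resp ∩ₐ-swap cut₂ in₂) ,
       Similar-join (Similar-resp ∩ₐ-swap rest₁ out₁) (Similar-resp ∩ₐ-swap rest₂ out₂)

  back-and-forth : ∀ m {n} (ρ σ : Env B n) → Equivalent (m + m) ρ σ →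
    ∀ x → Σ Carrier λ y → Equivalent m (extend B x ρ) (extend B y σ)
  back-and-forth m ρ σ equiv x =
    let (y , _ , agree-in , agree-out) = respond m ρ σ (↓ 1ᴮ) 1ᴮ x equiv
    in y , Similar-join (Similar-resp ≗ₐ-refl ↓1-∩ agree-in) agree-out

module Preservation {c ℓ : Level} (em : ExcludedMiddle (c ⊔ ℓ)) (B : BooleanAlgebra c ℓ)
                    (atomic : Atomic B) where
  open BooleanAlgebra B using (_≈_; sym; trans; ∧-congʳ; ∧-complementʳ)
  open OrderAndAtoms B
  open AtomPredicates B
  open Counting B
  open Similarity B
  open BackAndForth em B

  -- the precision of atom counting that suffices to evaluate φ
  bound : ∀ {n} → Formula n → ℕ
  bound (s ≐ t)  = 1
  bound (Cₛ k t) = suc k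
  bound tt       = 0
  bound ff       = 0
  bound (φ ∧' ψ) = bound φ ⊔ℕ bound ψ
  bound (φ ∨' ψ) = bound φ ⊔ℕ bound ψ
  bound (φ ⇒' ψ) = bound φ ⊔ℕ bound ψ
  bound (¬' φ)   = bound φ
  bound (∀' φ)   = bound φ + bound φ
  bound (∃' φ)   = bound φ + bound φ

  ⊔-left : ∀ {i j m} → i ⊔ℕ j ≤ℕ m → i ≤ℕ m
  ⊔-left = ℕ.≤-trans (ℕ.m≤m⊔n _ _)

  ⊔-right : ∀ {i j m} → i ⊔ℕ j ≤ℕ m → j ≤ℕ m
  ⊔-right = ℕ.≤-trans (ℕ.m≤n⊔m _ _)

  preserve : ∀ {n} (φ : Formula n) {m} {ρ σ : Env B n} → bound φ ≤ℕ m → Equivalent m ρ σ →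
    ⟦_⟧ B φ ρ → ⟦_⟧ B φ σ
  preserve (s ≐ t) {ρ = ρ} {σ} 1≤m equiv (lift s≈t) =
    lift (≤-antisym (included s t s≈t) (included t s (sym s≈t)))
    where
      -- u ≈ v under ρ leaves no atom in u - v, hence none under σ
      included : ∀ u v → ⟦_⟧ₜ B u ρ ≈ ⟦_⟧ₜ B v ρ → ⟦_⟧ₜ B u σ ≤ ⟦_⟧ₜ B v σ
      included u v u≈v = difference-0⇒≤ (no-atoms⇒0 em atomic λ h →
        zero-has-no-atoms (trans (∧-congʳ u≈v) (∧-complementʳ _))
          (proj₂ (Equivalent⇒Agree equiv (u ∩ (∁ v)) 1 1≤m) h))
  preserve (Cₛ k t) k<m equiv h =
    HasAtoms⇒AtLeastAtoms (proj₁ (Equivalent⇒Agree equiv t (suc k) k<m) (AtLeastAtoms⇒HasAtoms h))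
  preserve tt _ _ h = h
  preserve ff _ _ ()
  preserve (φ ∧' ψ) b equiv (p , q) = preserve φ (⊔-left b) equiv p , preserve ψ (⊔-right b) equiv q
  preserve (φ ∨' ψ) b equiv = Sum.map (preserve φ (⊔-left b) equiv) (preserve ψ (⊔-right b) equiv)
  preserve (φ ⇒' ψ) b equiv f =
    preserve ψ (⊔-right b) equiv ∘ f ∘ preserve φ (⊔-left b) (Similar-sym equiv)
  preserve (¬' φ) b equiv f = f ∘ preserve φ b (Similar-sym equiv)
  preserve (∀' φ) {ρ = ρ} {σ} b equiv f y =
    let (x , equiv′) = back-and-forth (bound φ) σ ρ (Similar-≤ b (Similar-sym equiv)) y
    in preserve φ ℕ.≤-refl (Similar-sym equiv′) (f x)
  preserve (∃' φ) {ρ = ρ} {σ} b equiv (x , p) =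
    let (y , equiv′) = back-and-forth (bound φ) ρ σ (Similar-≤ b equiv) x
    in y , preserve φ ℕ.≤-refl equiv′ p

-- Suppose φ defined such an ideal Fin, and let N bound the counting precision
-- of φ.  Elements outside Fin have at least N atoms.  Splitting 1 ∉ Fin gives
-- y ∉ Fin with 1 - y ∉ Fin, whose exact twin x has N atoms, so x ∈ Fin; but
-- x and y are N-equivalent, so φ(x) gives φ(y).
theorem4 : ∀ {c ℓ} → ExcludedMiddle (c ⊔ ℓ) →
    (B : BooleanAlgebra c ℓ) → Infinite B → Atomic B →
    (φ : Formula 1) → ¬ IsFinIdeal B (Def B φ)
theorem4 em B _ atomic φ ((_ , _ , _ , 1∉Fin) , small∈Fin , splits) =
  let (y , _ , y∉Fin , rest∉Fin) = splits (BooleanAlgebra.⊤ B) 1∉Fin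
      (x , x-exact , x≋y) = exact-twin (many y y∉Fin) (many _ rest∉Fin)
  in y∉Fin (preserve φ ℕ.≤-refl x≋y (small∈Fin (bound φ) x (proj₂ x-exact ∘ AtLeastAtoms⇒HasAtoms)))
  where
    open AtomPredicates B
    open Counting B
    open Similarity B
    open Preservation em B atomic
    many : ∀ z → ¬ Def B φ z → HasAtoms (bound φ) (↓ z)
    many z z∉Fin with em {AtLeastAtoms B (suc (bound φ)) z}
    ... | yes more = HasAtoms-≤ (ℕ.n≤1+n _) (AtLeastAtoms⇒HasAtoms more)
    ... | no  few  = ⊥-elim (z∉Fin (small∈Fin (bound φ) z few))
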